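{- Let $G$ be an equitably 3-colorable graph on $n\ge 2$ vertices and let $k\ge 2$, $l\ge 1$ be integers. If $3$ divides $n$ or $k=2$, then $\chi_{=}(G\circ^l C_{2k})=3$.
   Context: All graphs are finite, simple and connected. $C_m$ denotes the cycle on $m$ vertices. A graph is equitably $k$-colorable if its vertex set can be partitioned into $k$ (possibly empty) independent sets $V_1,\dots,V_k$ with $||V_i|-|V_j||\le 1$ for all $i,j$; $\chi_{=}(G)$ is the least $k$ for which $G$ is equitably $k$-colorable. The corona $G\circ H$ is formed from one copy of $G$ and $|V(G)|$ copies of $H$, the $i$-th vertex of $G$ being joined to every vertex of the $i$-th copy of $H$; $G\circ^1 H=G\circ H$ and $G\circ^l H=(G\circ^{l-1}H)\circ H$ for $l\ge 2$. -}

module Defs where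

open import Data.Bool using (Bool; true; false; _∧_; _∨_)
open import Data.Nat using (ℕ; zero; suc; _+_; _*_; _≤_; _<_; _≡ᵇ_)
open import Data.Fin using (Fin; toℕ; splitAt; remQuot)
open import Data.Fin.Properties using () renaming (_≟_ to _≟ᶠ_)
open import Data.Sum using (_⊎_; inj₁; inj₂)
open import Data.Product using (_×_; _,_; ∃-syntax)
open import Data.List using (List; length; filter; allFin)
open import Relation.Nullary using (¬_; does)
open import Relation.Binary.PropositionalEquality using (_≡_; _≢_)

record Graph : Set where
  constructor mkGraph
  field
    n   : ℕ
    adj : Fin n → Fin n → Bool
open Graph public

Simple : Graph → Set
Simple G = (∀ i j → adj G i j ≡ adj G j i) × (∀ i → adj G i i ≡ false)

data Walk (G : Graph) : Fin (n G) → Fin (n G) → Set where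
  here : ∀ {i} → Walk G i i
  step : ∀ {i j k} → adj G i j ≡ true → Walk G j k → Walk G i k

Connected : Graph → Set
Connected G = ∀ i j → Walk G i j

-- Cycle C_m on vertices 0..m-1, i adjacent to i+1 (mod m).
cycle : ℕ → Graph
cycle m = mkGraph m (λ i j → nb (toℕ i) (toℕ j) ∨ nb (toℕ j) (toℕ i))
  where
  nb : ℕ → ℕ → Bool
  nb a b = (suc a ≡ᵇ b) ∨ ((b ≡ᵇ 0) ∧ (suc a ≡ᵇ m))

-- Corona G ∘ H: vertices Fin (n + n * m); the first n are the copy of G,
-- vertex (i , a) (via remQuot) is vertex a of the i-th copy of H.
corona : Graph → Graph → Graph
corona G H = mkGraph (n G + n G * n H) ad
  where
  eqᶠ : Fin (n G) → Fin (n G) → Bool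
  eqᶠ i j = does (i ≟ᶠ j)
  ad : Fin (n G + n G * n H) → Fin (n G + n G * n H) → Bool
  ad u v with splitAt (n G) u | splitAt (n G) v
  ... | inj₁ i | inj₁ j = adj G i j
  ... | inj₁ i | inj₂ y with remQuot (n H) y
  ...   | (j , _) = eqᶠ i j
  ad u v | inj₂ x | inj₁ j with remQuot (n H) x
  ...   | (i , _) = eqᶠ i j
  ad u v | inj₂ x | inj₂ y with remQuot (n H) x | remQuot (n H) y
  ...   | (i , a) | (j , b) = eqᶠ i j ∧ adj H a b

coronaIter : ℕ → Graph → Graph → Graph
coronaIter zero    G H = G
coronaIter (suc l) G H = corona (coronaIter l G H) H

classSize : ∀ {m k} → (Fin m → Fin k) → Fin k → ℕ
classSize {m} c a = length (filter (λ v → c v ≟ᶠ a) (allFin m))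

EquitablyColorable : Graph → ℕ → Set
EquitablyColorable G k =
  ∃[ c ] ((∀ i j → adj G i j ≡ true → c i ≢ c j) ×
          (∀ a b → classSize {n G} {k} c a ≤ suc (classSize c b)))

EqChromaticNumberIs : Graph → ℕ → Set
EqChromaticNumberIs G k =
  EquitablyColorable G k × (∀ j → j < k → ¬ EquitablyColorable G j)

-- Colour G ∘ C, where C is bipartite with both sides of size k (as C_{2k} is), by
-- keeping a proper 3-colouring c of G and giving the copy of C at a vertex v the two
-- colours other than c v, one per side. Each copy then adds k vertices to every colour
-- except c v, so the class sizes become s′ a = s a + k (n − s a). Equal class sizes,
-- which an equitable colouring has when 3 ∣ n, stay equal; for k = 2 we get
-- s′ a = 2n − s a, which preserves equitability. Iterating gives the upper bound, and a
-- vertex together with an edge of its copy of C is a triangle, which needs 3 colours.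

module Submission where

open import Defs
open import Data.Nat using (ℕ; _≤_; _*_)
open import Data.Nat.Divisibility using (_∣_)
open import Data.Sum using (_⊎_)
open import Relation.Binary.PropositionalEquality using (_≡_)

open import Data.Bool using (true; false; if_then_else_; _∧_; _∨_; T)
open import Data.Bool.Properties using (T-≡; T-∨; T-∧)
open import Data.Nat using (zero; suc; _+_; _<_; _≡ᵇ_; s≤s)
open import Data.Nat.Properties
open import Data.Nat.Divisibility using (divides)
open import Data.Nat.Tactic.RingSolver using (solve-∀)
open import Data.Fin using (Fin; zero; suc; toℕ; fromℕ<; splitAt; remQuot; quotient; combine; punchIn; _↑ˡ_; _↑ʳ_)
open import Data.Fin.Properties using (splitAt-↑ˡ; splitAt-↑ʳ; remQuot-combine; punchInᵢ≢i; punchIn-injective; pigeonhole)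
  renaming (_≟_ to _≟ᶠ_)
open import Data.List using (filter; tabulate; length)
open import Data.Product using (_×_; _,_; ∃-syntax)
open import Data.Sum using (inj₁; inj₂; [_,_]′)
import Data.Sum as Sum
open import Function using (_∘_; Equivalence)
open import Relation.Nullary using (¬_; does; yes; no)
open import Relation.Nullary.Decidable using (dec-true)
open import Data.Vec.Functional using ([]; _∷_)
open import Relation.Binary.PropositionalEquality using (refl; sym; trans; cong; cong₂; _≢_; module ≡-Reasoning)
open import Algebra.Properties.Semiring.Sum +-*-semiring
  using (sum-syntax; ∑-distrib-+; ∑-comm; sum-cong-≗; sum-replicate-zero; *-distribˡ-sum)

open Equivalence using (to; from)

∑-const : ∀ m k → ∑[ i < m ] k ≡ m * k
∑-const zero    k = refl
∑-const (suc m) k = cong (k +_) (∑-const m k)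

∑-splitAt : ∀ m n (f : Fin (m + n) → ℕ) →
  ∑[ v < m + n ] f v ≡ ∑[ i < m ] f (i ↑ˡ n) + ∑[ j < n ] f (m ↑ʳ j)
∑-splitAt zero    n f = refl
∑-splitAt (suc m) n f =
  trans (cong (f zero +_) (∑-splitAt m n (f ∘ suc))) (sym (+-assoc (f zero) _ _))

∑-combine : ∀ m n (f : Fin (m * n) → ℕ) →
  ∑[ v < m * n ] f v ≡ ∑[ i < m ] ∑[ j < n ] f (combine i j)
∑-combine zero    n f = refl
∑-combine (suc m) n f =
  trans (∑-splitAt n (m * n) f) (cong (∑[ j < n ] f (j ↑ˡ (m * n)) +_) (∑-combine m n (f ∘ (n ↑ʳ_))))

δ : ∀ {r} → Fin r → Fin r → ℕ
δ x y = if does (x ≟ᶠ y) then 1 else 0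

≟-true⇒≡ : ∀ {r} (i j : Fin r) → does (i ≟ᶠ j) ≡ true → i ≡ j
≟-true⇒≡ i j e with i ≟ᶠ j
≟-true⇒≡ i j _  | yes i≡j = i≡j
≟-true⇒≡ i j () | no  _

∑-δ : ∀ {r} (f : Fin r → ℕ) x → ∑[ y < r ] (f y * δ x y) ≡ f x
∑-δ {suc r} f zero = begin
  f zero * 1 + ∑[ y < r ] (f (suc y) * 0)  ≡⟨ cong₂ _+_ (*-identityʳ (f zero)) (sum-cong-≗ (*-zeroʳ ∘ f ∘ suc)) ⟩
  f zero + ∑[ y < r ] 0                    ≡⟨ cong (f zero +_) (sum-replicate-zero r) ⟩
  f zero + 0                               ≡⟨ +-identityʳ (f zero) ⟩
  f zero                                   ∎
  where open ≡-Reasoning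
∑-δ {suc r} f (suc x) = begin
  f zero * 0 + ∑[ y < r ] (f (suc y) * δ x y)  ≡⟨ cong (_+ ∑[ y < r ] (f (suc y) * δ x y)) (*-zeroʳ (f zero)) ⟩
  ∑[ y < r ] (f (suc y) * δ x y)               ≡⟨ ∑-δ (f ∘ suc) x ⟩
  f (suc x)                                    ∎
  where open ≡-Reasoning

classSize-∑ : ∀ {m r} (c : Fin m → Fin r) y → classSize c y ≡ ∑[ v < m ] δ (c v) y
classSize-∑ {m} c y = length-filter-tabulate m
  where
  length-filter-tabulate : ∀ p {f : Fin p → Fin m} →
    length (filter (λ v → c v ≟ᶠ y) (tabulate f)) ≡ ∑[ v < p ] δ (c (f v)) y
  length-filter-tabulate zero        = refl
  length-filter-tabulate (suc p) {f} with does (c (f zero) ≟ᶠ y)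
  ... | true  = cong suc (length-filter-tabulate p)
  ... | false = length-filter-tabulate p

∑-fibres : ∀ {m r} (c : Fin m → Fin r) (h : Fin r → ℕ) →
  ∑[ v < m ] h (c v) ≡ ∑[ y < r ] (h y * classSize c y)
∑-fibres {m} {r} c h = begin
  ∑[ v < m ] h (c v)                       ≡⟨ sum-cong-≗ (λ v → ∑-δ h (c v)) ⟨
  ∑[ v < m ] ∑[ y < r ] (h y * δ (c v) y)  ≡⟨ ∑-comm (λ v y → h y * δ (c v) y) ⟩
  ∑[ y < r ] ∑[ v < m ] (h y * δ (c v) y)  ≡⟨ sum-cong-≗ (λ y → *-distribˡ-sum (h y) (λ v → δ (c v) y)) ⟨
  ∑[ y < r ] (h y * ∑[ v < m ] δ (c v) y)  ≡⟨ sum-cong-≗ (λ y → cong (h y *_) (classSize-∑ c y)) ⟨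
  ∑[ y < r ] (h y * classSize c y)         ∎
  where open ≡-Reasoning

∑-classSize : ∀ {m r} (c : Fin m → Fin r) → ∑[ y < r ] classSize c y ≡ m
∑-classSize {m} {r} c = begin
  ∑[ y < r ] classSize c y        ≡⟨ sum-cong-≗ (λ y → *-identityˡ (classSize c y)) ⟨
  ∑[ y < r ] (1 * classSize c y)  ≡⟨ ∑-fibres c (λ _ → 1) ⟨
  ∑[ v < m ] 1                    ≡⟨ ∑-const m 1 ⟩
  m * 1                           ≡⟨ *-identityʳ m ⟩
  m                               ∎
  where open ≡-Reasoning

Proper : ∀ {r} (G : Graph) → (Fin (n G) → Fin r) → Set
Proper G c = ∀ u v → adj G u v ≡ true → c u ≢ c v

parity : ℕ → Fin 2
parity zero          = zero
parity (suc zero)    = suc zero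
parity (suc (suc n)) = parity n

parity-suc : ∀ n → parity (suc n) ≢ parity n
parity-suc zero          ()
parity-suc (suc zero)    ()
parity-suc (suc (suc n)) = parity-suc n

parity-2* : ∀ k → parity (2 * k) ≡ zero
parity-2* zero    = refl
parity-2* (suc k) rewrite *-suc 2 k = parity-2* k

∑-parity : ∀ k (h : Fin 2 → ℕ) → ∑[ b < 2 * k ] h (parity (toℕ b)) ≡ k * (h zero + h (suc zero))
∑-parity zero    h = refl
∑-parity (suc k) h = begin
  S (2 * suc k)                           ≡⟨ cong S (*-suc 2 k) ⟩
  h zero + (h (suc zero) + S (2 * k))     ≡⟨ +-assoc (h zero) (h (suc zero)) (S (2 * k)) ⟨
  h zero + h (suc zero) + S (2 * k)       ≡⟨ cong (h zero + h (suc zero) +_) (∑-parity k h) ⟩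
  suc k * (h zero + h (suc zero))         ∎
  where
  open ≡-Reasoning
  S : ℕ → ℕ
  S m = ∑[ b < m ] h (parity (toℕ b))

CyclicSucc : ℕ → ℕ → ℕ → Set
CyclicSucc m x y = suc x ≡ y ⊎ (y ≡ 0 × suc x ≡ m)

cycle-adj⇒CyclicSucc : ∀ {m} (a b : Fin m) → adj (cycle m) a b ≡ true →
  CyclicSucc m (toℕ a) (toℕ b) ⊎ CyclicSucc m (toℕ b) (toℕ a)
cycle-adj⇒CyclicSucc {m} a b ab = Sum.map succ succ (to T-∨ (from T-≡ ab))
  where
  succ : ∀ {x y} → T ((suc x ≡ᵇ y) ∨ ((y ≡ᵇ 0) ∧ (suc x ≡ᵇ m))) → CyclicSucc m x y
  succ {x} {y} t with to T-∨ t
  ... | inj₁ x+1≡y  = inj₁ (≡ᵇ⇒≡ (suc x) y x+1≡y)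
  ... | inj₂ wraps with to T-∧ wraps
  ...   | y≡0 , x+1≡m = inj₂ (≡ᵇ⇒≡ y 0 y≡0 , ≡ᵇ⇒≡ (suc x) m x+1≡m)

CyclicSucc-parity : ∀ k {x y} → CyclicSucc (2 * k) x y → parity x ≢ parity y
CyclicSucc-parity k {x} (inj₁ refl)            = parity-suc x ∘ sym
CyclicSucc-parity k {x} (inj₂ (refl , x+1≡2k)) =
  parity-suc x ∘ trans (trans (cong parity x+1≡2k) (parity-2* k)) ∘ sym

BalancedBipartite : Graph → ℕ → Set
BalancedBipartite C k = ∃[ d ] Proper C d × (∀ y → classSize {n C} {2} d y ≡ k)

cycle-balancedBipartite : ∀ k → BalancedBipartite (cycle (2 * k)) k
cycle-balancedBipartite k = d , proper , size
  where
  open ≡-Reasoning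
  d : Fin (2 * k) → Fin 2
  d = parity ∘ toℕ
  proper : Proper (cycle (2 * k)) d
  proper a b ab with cycle-adj⇒CyclicSucc a b ab
  ... | inj₁ a→b = CyclicSucc-parity k a→b
  ... | inj₂ b→a = CyclicSucc-parity k b→a ∘ sym
  δ-Fin2 : ∀ y → δ zero y + δ (suc zero) y ≡ 1
  δ-Fin2 zero       = refl
  δ-Fin2 (suc zero) = refl
  size : ∀ y → classSize d y ≡ k
  size y = begin
    classSize d y                     ≡⟨ classSize-∑ d y ⟩
    ∑[ b < 2 * k ] δ (d b) y          ≡⟨ ∑-parity k (λ z → δ z y) ⟩
    k * (δ zero y + δ (suc zero) y)   ≡⟨ cong (k *_) (δ-Fin2 y) ⟩
    k * 1                             ≡⟨ *-identityʳ k ⟩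
    k                                 ∎

coronaColouring : (H C : Graph) → (Fin (n H) → Fin 3) → (Fin (n C) → Fin 2) → Fin (n (corona H C)) → Fin 3
coronaColouring H C c d = [ c , copy ]′ ∘ splitAt (n H)
  where
  copy : Fin (n H * n C) → Fin 3
  copy x = let (i , b) = remQuot (n C) x in punchIn (c i) (d b)

coronaColouring-proper : ∀ {H C} {c : Fin (n H) → Fin 3} {d : Fin (n C) → Fin 2} →
  Proper H c → Proper C d → Proper (corona H C) (coronaColouring H C c d)
coronaColouring-proper {H} {C} {c} {d} c-proper d-proper u v uv
  with splitAt (n H) u | splitAt (n H) v
... | inj₁ i | inj₁ j = c-proper i j uv
... | inj₁ i | inj₂ y with refl ← ≟-true⇒≡ i (quotient (n C) y) uv = punchInᵢ≢i _ _ ∘ sym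
... | inj₂ x | inj₁ j with refl ← ≟-true⇒≡ (quotient (n C) x) j uv = punchInᵢ≢i _ _
... | inj₂ x | inj₂ y = copy≢copy (quotient (n C) x) (quotient (n C) y) _ _ uv
  where
  copy≢copy : ∀ i j a b → does (i ≟ᶠ j) ∧ adj C a b ≡ true → punchIn (c i) (d a) ≢ punchIn (c j) (d b)
  copy≢copy i j a b e with i≡j , ab ← to T-∧ (from T-≡ e) with refl ← ≟-true⇒≡ i j (to T-≡ i≡j) =
    d-proper a b (to T-≡ ab) ∘ punchIn-injective (c i) (d a) (d b)

coronaColouring-hub : ∀ H C (c : Fin (n H) → Fin 3) (d : Fin (n C) → Fin 2) i →
  coronaColouring H C c d (i ↑ˡ n H * n C) ≡ c i
coronaColouring-hub H C c d i rewrite splitAt-↑ˡ (n H) i (n H * n C) = refl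

coronaColouring-copy : ∀ H C (c : Fin (n H) → Fin 3) (d : Fin (n C) → Fin 2) i b →
  coronaColouring H C c d (n H ↑ʳ combine i b) ≡ punchIn (c i) (d b)
coronaColouring-copy H C c d i b rewrite splitAt-↑ʳ (n H) (n H * n C) (combine i b) =
  cong (λ (j , b′) → punchIn (c j) (d b′)) (remQuot-combine i b)

δ-punchIn : ∀ (x a : Fin 3) → δ (punchIn x zero) a + δ (punchIn x (suc zero)) a + δ x a ≡ 1
δ-punchIn zero             zero             = refl
δ-punchIn zero             (suc zero)       = refl
δ-punchIn zero             (suc (suc zero)) = refl
δ-punchIn (suc zero)       zero             = refl
δ-punchIn (suc zero)       (suc zero)       = refl
δ-punchIn (suc zero)       (suc (suc zero)) = refl
δ-punchIn (suc (suc zero)) zero             = refl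
δ-punchIn (suc (suc zero)) (suc zero)       = refl
δ-punchIn (suc (suc zero)) (suc (suc zero)) = refl

classSize-coronaColouring : ∀ H C (c : Fin (n H) → Fin 3) (d : Fin (n C) → Fin 2) a →
  classSize (coronaColouring H C c d) a ≡ classSize c a + ∑[ i < n H ] ∑[ b < n C ] δ (punchIn (c i) (d b)) a
classSize-coronaColouring H C c d a = begin
  classSize e a                                                             ≡⟨ classSize-∑ e a ⟩
  ∑[ v < n H + n H * n C ] δ (e v) a                                        ≡⟨ ∑-splitAt (n H) (n H * n C) _ ⟩
  ∑[ i < n H ] δ (e (i ↑ˡ _)) a + ∑[ x < n H * n C ] δ (e (n H ↑ʳ x)) a     ≡⟨ cong₂ _+_ hubs copies ⟩
  classSize c a + ∑[ i < n H ] ∑[ b < n C ] δ (punchIn (c i) (d b)) a       ∎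
  where
  open ≡-Reasoning
  e : Fin (n (corona H C)) → Fin 3
  e = coronaColouring H C c d
  hubs : ∑[ i < n H ] δ (e (i ↑ˡ n H * n C)) a ≡ classSize c a
  hubs = trans (sum-cong-≗ λ i → cong (λ x → δ x a) (coronaColouring-hub H C c d i)) (sym (classSize-∑ c a))
  copies : ∑[ x < n H * n C ] δ (e (n H ↑ʳ x)) a ≡ ∑[ i < n H ] ∑[ b < n C ] δ (punchIn (c i) (d b)) a
  copies = trans (∑-combine (n H) (n C) _) (sum-cong-≗ λ i → sum-cong-≗ λ b →
    cong (λ x → δ x a) (coronaColouring-copy H C c d i b))

classSize-copy : ∀ {m k} (d : Fin m → Fin 2) → (∀ y → classSize d y ≡ k) → ∀ x a →
  ∑[ b < m ] δ (punchIn x (d b)) a + k * δ x a ≡ k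
classSize-copy {m} {k} d balanced x a = begin
  ∑[ b < m ] p (d b) + k * δ x a                ≡⟨ cong (_+ k * δ x a) (∑-fibres d p) ⟩
  ∑[ y < 2 ] (p y * classSize d y) + k * δ x a  ≡⟨ cong (_+ k * δ x a) (sum-cong-≗ λ y → cong (p y *_) (balanced y)) ⟩
  ∑[ y < 2 ] (p y * k) + k * δ x a              ≡⟨ factor (p zero) (p (suc zero)) (δ x a) k ⟩
  k * (p zero + p (suc zero) + δ x a)           ≡⟨ cong (k *_) (δ-punchIn x a) ⟩
  k * 1                                         ≡⟨ *-identityʳ k ⟩
  k                                             ∎
  where
  open ≡-Reasoning
  p : Fin 2 → ℕ
  p y = δ (punchIn x y) a
  factor : ∀ p₀ p₁ r k → p₀ * k + (p₁ * k + 0) + k * r ≡ k * (p₀ + p₁ + r)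
  factor = solve-∀

coronaColouring-classSize : ∀ {H C k} (c : Fin (n H) → Fin 3) (d : Fin (n C) → Fin 2) →
  (∀ y → classSize d y ≡ k) →
  ∀ a → classSize (coronaColouring H C c d) a + k * classSize c a ≡ classSize c a + n H * k
coronaColouring-classSize {H} {C} {k} c d balanced a = begin
  classSize (coronaColouring H C c d) a + k * classSize c a  ≡⟨ cong (_+ k * classSize c a) (classSize-coronaColouring H C c d a) ⟩
  classSize c a + ∑[ i < n H ] copies i + k * classSize c a  ≡⟨ +-assoc (classSize c a) _ _ ⟩
  classSize c a + (∑[ i < n H ] copies i + k * classSize c a) ≡⟨ cong (classSize c a +_) copies+hubs ⟩
  classSize c a + n H * k                                    ∎
  where
  open ≡-Reasoning
  copies : Fin (n H) → ℕ
  copies i = ∑[ b < n C ] δ (punchIn (c i) (d b)) a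
  copies+hubs : ∑[ i < n H ] copies i + k * classSize c a ≡ n H * k
  copies+hubs = begin
    ∑[ i < n H ] copies i + k * classSize c a            ≡⟨ cong (λ t → ∑[ i < n H ] copies i + k * t) (classSize-∑ c a) ⟩
    ∑[ i < n H ] copies i + k * ∑[ i < n H ] δ (c i) a    ≡⟨ cong (∑[ i < n H ] copies i +_) (*-distribˡ-sum k (λ i → δ (c i) a)) ⟩
    ∑[ i < n H ] copies i + ∑[ i < n H ] (k * δ (c i) a)  ≡⟨ ∑-distrib-+ copies (λ i → k * δ (c i) a) ⟨
    ∑[ i < n H ] (copies i + k * δ (c i) a)               ≡⟨ sum-cong-≗ (λ i → classSize-copy d balanced (c i) a) ⟩
    ∑[ i < n H ] k                                        ≡⟨ ∑-const (n H) k ⟩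
    n H * k                                               ∎

ColouringWith : Graph → ((Fin 3 → ℕ) → Set) → Set
ColouringWith G P = ∃[ c ] Proper G c × P (classSize c)

-- s′ a = s a + k (N − s a), written without truncated subtraction.
CoronaStable : ℕ → ((Fin 3 → ℕ) → Set) → Set
CoronaStable k P = ∀ N {s s′ : Fin 3 → ℕ} → (∀ a → s′ a + k * s a ≡ s a + N * k) → P s → P s′

coronaIter-colouring : ∀ {C k P} → BalancedBipartite C k → CoronaStable k P →
  ∀ l {G} → ColouringWith G P → ColouringWith (coronaIter l G C) P
coronaIter-colouring _ _ zero colouring = colouring
coronaIter-colouring {C} C-bipartite@(d , d-proper , d-balanced) stable (suc l) {G} colouring
  with c , c-proper , c-sizes ← coronaIter-colouring C-bipartite stable l colouring =
  coronaColouring H C c d , coronaColouring-proper c-proper d-proper ,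
  stable (n H) (coronaColouring-classSize {H} {C} c d d-balanced) c-sizes
  where
  H : Graph
  H = coronaIter l G C

Balanced : (Fin 3 → ℕ) → Set
Balanced s = ∀ a b → s a ≡ s b

Equitable : (Fin 3 → ℕ) → Set
Equitable s = ∀ a b → s a ≤ suc (s b)

Balanced⇒Equitable : ∀ {s} → Balanced s → Equitable s
Balanced⇒Equitable balanced a b = m≤n⇒m≤1+n (≤-reflexive (balanced a b))

balanced-coronaStable : ∀ k → CoronaStable k Balanced
balanced-coronaStable k N {s} {s′} sizes balanced a b = +-cancelʳ-≡ (k * s b) (s′ a) (s′ b) (begin
  s′ a + k * s b  ≡⟨ cong (λ t → s′ a + k * t) (balanced b a) ⟩
  s′ a + k * s a  ≡⟨ sizes a ⟩
  s a + N * k     ≡⟨ cong (_+ N * k) (balanced a b) ⟩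
  s b + N * k     ≡⟨ sizes b ⟨
  s′ b + k * s b  ∎)
  where open ≡-Reasoning

equitable-coronaStable : CoronaStable 2 Equitable
equitable-coronaStable N {s} {s′} sizes equitable a b = +-cancelʳ-≤ (s a) (s′ a) (suc (s′ b)) (begin
  s′ a + s a        ≡⟨ trans (complement a) (sym (complement b)) ⟩
  s′ b + s b        ≤⟨ +-monoʳ-≤ (s′ b) (equitable b a) ⟩
  s′ b + suc (s a)  ≡⟨ +-suc (s′ b) (s a) ⟩
  suc (s′ b) + s a  ∎)
  where
  open ≤-Reasoning
  complement : ∀ a → s′ a + s a ≡ N * 2
  complement a = +-cancelʳ-≡ (s a) (s′ a + s a) (N * 2)
    (trans (regroup (s′ a) (s a)) (trans (sizes a) (+-comm (s a) (N * 2))))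
    where
    regroup : ∀ x y → x + y + y ≡ x + 2 * y
    regroup = solve-∀

third-of-sum : ∀ {x y z q} → x ≤ suc y → x ≤ suc z → y ≤ suc x → z ≤ suc x → x + (y + z) ≡ q * 3 → x ≡ q
third-of-sum {x} {y} {z} {q} x≤1+y x≤1+z y≤1+x z≤1+x total = ≤-antisym x≤q q≤x
  where
  open ≤-Reasoning
  triple : ∀ x → x * 3 ≡ x + (x + x)
  triple = solve-∀
  gather : ∀ x y z → x + (suc y + suc z) ≡ 2 + (x + (y + z))
  gather = solve-∀
  x≤q : x ≤ q
  x≤q = ≤-pred (*-cancelʳ-< 3 x (suc q) (begin-strict
    x * 3                  ≡⟨ triple x ⟩
    x + (x + x)            ≤⟨ +-monoʳ-≤ x (+-mono-≤ x≤1+y x≤1+z) ⟩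
    x + (suc y + suc z)    ≡⟨ gather x y z ⟩
    2 + (x + (y + z))      ≡⟨ cong (2 +_) total ⟩
    2 + q * 3              <⟨ n<1+n _ ⟩
    suc q * 3              ∎))
  q≤x : q ≤ x
  q≤x = ≤-pred (*-cancelʳ-< 3 q (suc x) (begin-strict
    q * 3                  ≡⟨ total ⟨
    x + (y + z)            ≤⟨ +-monoʳ-≤ x (+-mono-≤ y≤1+x z≤1+x) ⟩
    x + (suc x + suc x)    ≡⟨ gather x x x ⟩
    2 + (x + (x + x))      ≡⟨ cong (2 +_) (triple x) ⟨
    2 + x * 3              <⟨ n<1+n _ ⟩
    suc x * 3              ∎))

equitable⇒balanced : ∀ {s : Fin 3 → ℕ} q → Equitable s → ∑[ a < 3 ] s a ≡ q * 3 → Balanced s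
equitable⇒balanced {s} q equitable total a b = trans (third a) (sym (third b))
  where
  rotate₀ : ∀ a b c → a + (b + c) ≡ a + (b + (c + 0))
  rotate₀ = solve-∀
  rotate₁ : ∀ a b c → b + (a + c) ≡ a + (b + (c + 0))
  rotate₁ = solve-∀
  rotate₂ : ∀ a b c → c + (a + b) ≡ a + (b + (c + 0))
  rotate₂ = solve-∀
  third : ∀ a → s a ≡ q
  third zero             = third-of-sum (equitable _ _) (equitable _ _) (equitable _ _) (equitable _ _)
    (trans (rotate₀ (s zero) (s (suc zero)) (s (suc (suc zero)))) total)
  third (suc zero)       = third-of-sum (equitable _ _) (equitable _ _) (equitable _ _) (equitable _ _)
    (trans (rotate₁ (s zero) (s (suc zero)) (s (suc (suc zero)))) total)
  third (suc (suc zero)) = third-of-sum (equitable _ _) (equitable _ _) (equitable _ _) (equitable _ _)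
    (trans (rotate₂ (s zero) (s (suc zero)) (s (suc (suc zero)))) total)

triangle⇒¬colourable : ∀ {G u v w} → adj G u v ≡ true → adj G u w ≡ true → adj G v w ≡ true →
  ∀ j → j < 3 → ¬ EquitablyColorable G j
triangle⇒¬colourable {G} {u} {v} {w} uv uw vw j j<3 (c , proper , _)
  with pigeonhole j<3 (c ∘ (u ∷ v ∷ w ∷ []))
... | zero        , suc zero       , _             , same = proper u v uv same
... | zero        , suc (suc zero) , _             , same = proper u w uw same
... | suc zero    , suc (suc zero) , _             , same = proper v w vw same
... | suc _       , suc zero       , s≤s ()        , _
... | suc (suc _) , suc (suc zero) , s≤s (s≤s ()) , _

corona-hub-adj : ∀ H C i b → adj (corona H C) (i ↑ˡ n H * n C) (n H ↑ʳ combine i b) ≡ true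
corona-hub-adj H C i b
  rewrite splitAt-↑ˡ (n H) i (n H * n C) | splitAt-↑ʳ (n H) (n H * n C) (combine i b) =
  trans (cong (λ (j , _) → does (i ≟ᶠ j)) (remQuot-combine i b)) (dec-true (i ≟ᶠ i) refl)

corona-copy-adj : ∀ H C i {a b} → adj C a b ≡ true → adj (corona H C) (n H ↑ʳ combine i a) (n H ↑ʳ combine i b) ≡ true
corona-copy-adj H C i {a} {b} ab
  rewrite splitAt-↑ʳ (n H) (n H * n C) (combine {n H} {n C} i a)
        | splitAt-↑ʳ (n H) (n H * n C) (combine {n H} {n C} i b) =
  trans (cong₂ (λ (j , a′) (j′ , b′) → does (j ≟ᶠ j′) ∧ adj C a′ b′) (remQuot-combine i a) (remQuot-combine i b))
        (cong₂ _∧_ (dec-true (i ≟ᶠ i) refl) ab)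

corona-¬colourable : ∀ H C → Fin (n H) → (∃[ a ] ∃[ b ] adj C a b ≡ true) →
  ∀ j → j < 3 → ¬ EquitablyColorable (corona H C) j
corona-¬colourable H C i (a , b , ab) =
  triangle⇒¬colourable (corona-hub-adj H C i a) (corona-hub-adj H C i b) (corona-copy-adj H C i {a} {b} ab)

cycle-edge : ∀ {m} → 2 ≤ m → ∃[ a ] ∃[ b ] adj (cycle m) a b ≡ true
cycle-edge {suc zero}    (s≤s ())
cycle-edge {suc (suc m)} _ = zero , suc zero , refl

coronaIter-↑ : ∀ l {G C} → Fin (n G) → Fin (n (coronaIter l G C))
coronaIter-↑ zero    i = i
coronaIter-↑ (suc l) i = coronaIter-↑ l i ↑ˡ _

coronaIter-equitable-3∣ : ∀ {G C k} l → BalancedBipartite C k → 3 ∣ n G →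
  EquitablyColorable G 3 → EquitablyColorable (coronaIter l G C) 3
coronaIter-equitable-3∣ l C-bipartite (divides q n≡q*3) (c , c-proper , c-equitable)
  with c′ , c′-proper , c′-balanced ← coronaIter-colouring C-bipartite (balanced-coronaStable _) l
         (c , c-proper , equitable⇒balanced q c-equitable (trans (∑-classSize c) n≡q*3)) =
  c′ , c′-proper , Balanced⇒Equitable c′-balanced

coronaIter-equitable-2 : ∀ {G C} l → BalancedBipartite C 2 →
  EquitablyColorable G 3 → EquitablyColorable (coronaIter l G C) 3
coronaIter-equitable-2 l C-bipartite = coronaIter-colouring C-bipartite equitable-coronaStable l

theorem2 : (G : Graph) → Simple G → Connected G → 2 ≤ n G →
    EquitablyColorable G 3 →
    (k l : ℕ) → 2 ≤ k → 1 ≤ l →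
    (3 ∣ n G ⊎ k ≡ 2) →
    EqChromaticNumberIs (coronaIter l G (cycle (2 * k))) 3
theorem2 G _ _ 2≤n colourable k (suc l) 2≤k _ 3∣n⊎k≡2 = upper 3∣n⊎k≡2 , lower
  where
  C : Graph
  C = cycle (2 * k)
  upper : 3 ∣ n G ⊎ k ≡ 2 → EquitablyColorable (coronaIter (suc l) G C) 3
  upper (inj₁ 3∣n)  = coronaIter-equitable-3∣ (suc l) (cycle-balancedBipartite k) 3∣n colourable
  upper (inj₂ refl) = coronaIter-equitable-2 (suc l) (cycle-balancedBipartite 2) colourable
  lower : ∀ j → j < 3 → ¬ EquitablyColorable (coronaIter (suc l) G C) j
  lower = corona-¬colourable (coronaIter l G C) C (coronaIter-↑ l (fromℕ< 2≤n)) (cycle-edge (≤-trans 2≤k (m≤m+n k _)))
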